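{- Let $k\ge 1$ and let $L_2^k$ be the incidence structure defined as follows. Its points are a special point $D$ together with points $a_g, b_g, c_g$ for $g \in \mathbb{F}_2^k$. Its lines are the three special lines $A=\{a_g : g\in\mathbb{F}_2^k\}\cup\{D\}$, $B=\{b_g : g\in\mathbb{F}_2^k\}\cup\{D\}$, $C=\{c_g : g\in\mathbb{F}_2^k\}\cup\{D\}$, and the ordinary lines $\{a_g, b_{g+h}, c_h\}$ for $g,h\in\mathbb{F}_2^k$. Then the graph of lines of $L_2^k$ (vertices: the ordinary lines; two ordinary lines adjacent iff they share a point) is isomorphic to the bilinear forms graph $H_2(2,k)$.
   Context: For a prime power $q$ and positive integer $k$, the bilinear forms graph $H_q(2,k)$ has as vertices all $2\times k$ matrices over the field $\mathbb{F}_q$, two matrices being adjacent iff their difference has rank $1$. -}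

module Defs where

open import Data.Nat using (ℕ; suc)
open import Data.Bool using (Bool; false; true; _xor_)
open import Data.Fin using (Fin)
open import Data.Vec using (Vec; []; _∷_; zipWith; replicate; lookup; tabulate)
open import Data.Product using (_×_; _,_; Σ; ∃)
open import Data.Sum using (_⊎_)
open import Relation.Binary.PropositionalEquality using (_≡_; _≢_)
open import Relation.Nullary using (¬_)
open import Function.Bundles using (_↔_; _⇔_; Inverse)

F₂ : Set
F₂ = Bool

F₂^ : ℕ → Set
F₂^ n = Vec F₂ n

_⊕_ : ∀ {n} → F₂^ n → F₂^ n → F₂^ n
_⊕_ = zipWith _xor_

𝟎 : ∀ {n} → F₂^ n
𝟎 = replicate _ false

record Graph : Set₁ where
  field
    Vertex : Set
    Adj    : Vertex → Vertex → Set

open Graph public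

record GraphIso (G H : Graph) : Set where
  field
    bij : Vertex G ↔ Vertex H
    adj : ∀ u v → Adj G u v ⇔ Adj H (Inverse.to bij u) (Inverse.to bij v)

data Point (k : ℕ) : Set where
  D     : Point k
  a b c : F₂^ k → Point k

data Line (k : ℕ) : Set where
  A B C : Line k
  ord   : F₂^ k → F₂^ k → Line k

_∈ℓ_ : ∀ {k} → Point k → Line k → Set
_∈ℓ_ {k} p A = p ≡ D ⊎ Σ (F₂^ k) (λ g → p ≡ a g)
_∈ℓ_ {k} p B = p ≡ D ⊎ Σ (F₂^ k) (λ g → p ≡ b g)
_∈ℓ_ {k} p C = p ≡ D ⊎ Σ (F₂^ k) (λ g → p ≡ c g)
_∈ℓ_ p (ord g h) = p ≡ a g ⊎ (p ≡ b (g ⊕ h) ⊎ p ≡ c h)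

OrdinaryLine : ℕ → Set
OrdinaryLine k = F₂^ k × F₂^ k

toLine : ∀ {k} → OrdinaryLine k → Line k
toLine (g , h) = ord g h

LineGraph : ℕ → Graph
LineGraph k = record
  { Vertex = OrdinaryLine k
  ; Adj    = λ ℓ m → toLine ℓ ≢ toLine m
                     × ∃ (λ (p : Point k) → p ∈ℓ toLine ℓ × p ∈ℓ toLine m)
  }

Matrix : ℕ → ℕ → Set
Matrix m n = Vec (F₂^ n) m

_⊕ᴹ_ : ∀ {m n} → Matrix m n → Matrix m n → Matrix m n
_⊕ᴹ_ = zipWith _⊕_

_·_ : ∀ {n} → F₂ → F₂^ n → F₂^ n
false · v = 𝟎
true  · v = v

lincomb : ∀ {m n} → F₂^ m → Matrix m n → F₂^ n
lincomb []       []       = 𝟎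
lincomb (x ∷ cs) (r ∷ M) = (x · r) ⊕ lincomb cs M

Independent : ∀ {m n} → Matrix m n → Set
Independent {m} M = ∀ (cs : F₂^ m) → lincomb cs M ≡ 𝟎 → cs ≡ 𝟎

select : ∀ {r m n} → (Fin r → Fin m) → Matrix m n → Matrix r n
select f M = tabulate (λ i → lookup M (f i))

HasRank : ∀ {m n} → Matrix m n → ℕ → Set
HasRank {m} M r =
  Σ (Fin r → Fin m) (λ f → Independent (select f M))
  × (∀ (f : Fin (suc r) → Fin m) → ¬ Independent (select f M))

-- bilinear forms graph H₂(2,k) (matrix subtraction = addition over F₂)

BilinearFormsGraph : ℕ → Graph
BilinearFormsGraph k = record
  { Vertex = Matrix 2 k
  ; Adj    = λ M N → HasRank (M ⊕ᴹ N) 1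
  }

-- Identify the ordinary line {a_g, b_(g+h), c_h} with the matrix with rows g and h.
-- For two such lines, with difference rows x = g + g' and y = h + h', the lines share
-- a_g, b_(g+h) or c_h exactly when x = 0, x = y or y = 0, i.e. when the rows x, y are
-- linearly dependent; they are distinct exactly when (x, y) ≠ 0. Over F₂ these two
-- conditions together say precisely that the difference matrix has rank 1.
module Submission where

open import Defs
open import Algebra.Bundles using (AbelianGroup)
open import Algebra.Structures using (IsAbelianGroup)
open import Data.Bool using (true; false)
open import Data.Bool.Properties using (xor-assoc; xor-comm; xor-identityˡ; xor-identityʳ; xor-same)
import Data.Bool.Properties as Bool
open import Data.Empty using (⊥-elim)
open import Data.Fin using (Fin; zero; suc)
open import Data.Nat using (ℕ; _≤_)
open import Data.Product using (_×_; _,_; ∃)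
open import Data.Product.Function.NonDependent.Propositional using (_×-⇔_)
open import Data.Sum using (_⊎_; inj₁; inj₂)
open import Data.Vec using ([]; _∷_; lookup)
open import Data.Vec.Properties using (≡-dec; zipWith-assoc; zipWith-comm; zipWith-identityˡ; zipWith-identityʳ)
open import Function using (id; case_of_)
open import Function.Bundles using (_⇔_; mk⇔; mk↔ₛ′; Equivalence)
open import Function.Construct.Composition using (_⇔-∘_)
open import Function.Construct.Symmetry using (⇔-sym)
open import Function.Related.TypeIsomorphisms using (¬-cong-⇔)
open import Level using (0ℓ)
open import Relation.Binary.Definitions using (DecidableEquality)
open import Relation.Binary.PropositionalEquality using (_≡_; _≢_; refl; sym; trans; cong; cong₂; isEquivalence)
open import Relation.Nullary using (¬_; Dec; yes; no)
open import Relation.Nullary.Decidable using (_⊎-dec_; decidable-stable)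

⊕-isAbelianGroup : ∀ n → IsAbelianGroup _≡_ (_⊕_ {n}) 𝟎 id
⊕-isAbelianGroup n = record
  { isGroup = record
    { isMonoid = record
      { isSemigroup = record
        { isMagma = record { isEquivalence = isEquivalence ; ∙-cong = cong₂ _⊕_ }
        ; assoc = zipWith-assoc xor-assoc
        }
      ; identity = zipWith-identityˡ xor-identityˡ , zipWith-identityʳ xor-identityʳ
      }
    ; inverse = ⊕-self , ⊕-self
    ; ⁻¹-cong = id
    }
  ; comm = zipWith-comm xor-comm
  }
  where
  ⊕-self : ∀ {m} (x : F₂^ m) → x ⊕ x ≡ 𝟎
  ⊕-self []      = refl
  ⊕-self (β ∷ x) = cong₂ _∷_ (xor-same β) (⊕-self x)

⊕-abelianGroup : ℕ → AbelianGroup 0ℓ 0ℓ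
⊕-abelianGroup n = record { isAbelianGroup = ⊕-isAbelianGroup n }

module _ {n : ℕ} where
  open AbelianGroup (⊕-abelianGroup n) using (identityˡ; identityʳ; inverseʳ; commutativeSemigroup)
  open import Algebra.Properties.AbelianGroup (⊕-abelianGroup n) using (inverseʳ-unique)
  open import Algebra.Properties.CommutativeSemigroup commutativeSemigroup using (interchange)

  ⊕-identityˡ : (x : F₂^ n) → 𝟎 ⊕ x ≡ x
  ⊕-identityˡ = identityˡ

  ⊕-identityʳ : (x : F₂^ n) → x ⊕ 𝟎 ≡ x
  ⊕-identityʳ = identityʳ

  ⊕≡𝟎⇒≡ : {x y : F₂^ n} → x ⊕ y ≡ 𝟎 → x ≡ y
  ⊕≡𝟎⇒≡ x⊕y≡𝟎 = sym (inverseʳ-unique _ _ x⊕y≡𝟎)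

  ≡⇒⊕≡𝟎 : {x y : F₂^ n} → x ≡ y → x ⊕ y ≡ 𝟎
  ≡⇒⊕≡𝟎 {x} refl = inverseʳ x

  ⊕-transpose : {g h g′ h′ : F₂^ n} → g ⊕ h ≡ g′ ⊕ h′ → g ⊕ g′ ≡ h ⊕ h′
  ⊕-transpose {g} {h} {g′} {h′} e =
    ⊕≡𝟎⇒≡ (trans (interchange g g′ h h′) (≡⇒⊕≡𝟎 e))

  _≟_ : DecidableEquality (F₂^ n)
  _≟_ = ≡-dec Bool._≟_

-- The three nontrivial F₂-combinations of x and y are x, y and x + y.
Dependent : ∀ {n} → F₂^ n → F₂^ n → Set
Dependent x y = x ≡ 𝟎 ⊎ y ≡ 𝟎 ⊎ x ≡ y

dependent? : ∀ {n} (x y : F₂^ n) → Dec (Dependent x y)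
dependent? x y = (x ≟ 𝟎) ⊎-dec ((y ≟ 𝟎) ⊎-dec (x ≟ y))

dependent-sym : ∀ {n} {x y : F₂^ n} → Dependent x y → Dependent y x
dependent-sym (inj₁ x≡𝟎)        = inj₂ (inj₁ x≡𝟎)
dependent-sym (inj₂ (inj₁ y≡𝟎)) = inj₁ y≡𝟎
dependent-sym (inj₂ (inj₂ x≡y)) = inj₂ (inj₂ (sym x≡y))

independent-singleton⇔ : ∀ {n} {x : F₂^ n} → Independent (x ∷ []) ⇔ x ≢ 𝟎
independent-singleton⇔ {x = x} = mk⇔ to from
  where
  to : Independent (x ∷ []) → x ≢ 𝟎
  to ind x≡𝟎 = case ind (true ∷ []) (trans (⊕-identityʳ x) x≡𝟎) of λ ()

  from : x ≢ 𝟎 → Independent (x ∷ [])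
  from x≢𝟎 (false ∷ []) _     = refl
  from x≢𝟎 (true ∷ [])  x⊕𝟎≡𝟎 = ⊥-elim (x≢𝟎 (trans (sym (⊕-identityʳ x)) x⊕𝟎≡𝟎))

lincomb-pair : ∀ {n} s t (x y : F₂^ n) → lincomb (s ∷ t ∷ []) (x ∷ y ∷ []) ≡ (s · x) ⊕ (t · y)
lincomb-pair s t x y = cong ((s · x) ⊕_) (⊕-identityʳ (t · y))

independent-pair⇔ : ∀ {n} {x y : F₂^ n} → Independent (x ∷ y ∷ []) ⇔ (¬ Dependent x y)
independent-pair⇔ {x = x} {y} = mk⇔ to from
  where
  to : Independent (x ∷ y ∷ []) → ¬ Dependent x y
  to ind (inj₁ x≡𝟎) = case ind (true ∷ false ∷ []) vanishes of λ ()
    where vanishes = trans (lincomb-pair true false x y) (trans (⊕-identityʳ x) x≡𝟎)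
  to ind (inj₂ (inj₁ y≡𝟎)) = case ind (false ∷ true ∷ []) vanishes of λ ()
    where vanishes = trans (lincomb-pair false true x y) (trans (⊕-identityˡ y) y≡𝟎)
  to ind (inj₂ (inj₂ x≡y)) = case ind (true ∷ true ∷ []) vanishes of λ ()
    where vanishes = trans (lincomb-pair true true x y) (≡⇒⊕≡𝟎 x≡y)

  from : ¬ Dependent x y → Independent (x ∷ y ∷ [])
  from ¬dep (false ∷ false ∷ []) _ = refl
  from ¬dep (true ∷ false ∷ []) e = ⊥-elim (¬dep (inj₁ x≡𝟎))
    where x≡𝟎 = trans (sym (⊕-identityʳ x)) (trans (sym (lincomb-pair true false x y)) e)
  from ¬dep (false ∷ true ∷ []) e = ⊥-elim (¬dep (inj₂ (inj₁ y≡𝟎)))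
    where y≡𝟎 = trans (sym (⊕-identityˡ y)) (trans (sym (lincomb-pair false true x y)) e)
  from ¬dep (true ∷ true ∷ []) e = ⊥-elim (¬dep (inj₂ (inj₂ x≡y)))
    where x≡y = ⊕≡𝟎⇒≡ (trans (sym (lincomb-pair true true x y)) e)

rows-dependent : ∀ {n} {x y : F₂^ n} → Dependent x y →
                 ∀ i j → Dependent (lookup (x ∷ y ∷ []) i) (lookup (x ∷ y ∷ []) j)
rows-dependent dep zero       zero       = inj₂ (inj₂ refl)
rows-dependent dep zero       (suc zero) = dep
rows-dependent dep (suc zero) zero       = dependent-sym dep
rows-dependent dep (suc zero) (suc zero) = inj₂ (inj₂ refl)

rank-one-pair⇔ : ∀ {n} {x y : F₂^ n} →
                 HasRank (x ∷ y ∷ []) 1 ⇔ (¬ (x ≡ 𝟎 × y ≡ 𝟎) × Dependent x y)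
rank-one-pair⇔ {x = x} {y} = mk⇔ to from
  where
  nonzero-row : ∀ i → lookup (x ∷ y ∷ []) i ≢ 𝟎 → ¬ (x ≡ 𝟎 × y ≡ 𝟎)
  nonzero-row zero       x≢𝟎 (x≡𝟎 , _) = x≢𝟎 x≡𝟎
  nonzero-row (suc zero) y≢𝟎 (_ , y≡𝟎) = y≢𝟎 y≡𝟎

  to : HasRank (x ∷ y ∷ []) 1 → ¬ (x ≡ 𝟎 × y ≡ 𝟎) × Dependent x y
  to ((f , ind) , maximal) =
      nonzero-row (f zero) (Equivalence.to independent-singleton⇔ ind)
    , decidable-stable (dependent? x y)
        (λ ¬dep → maximal id (Equivalence.from independent-pair⇔ ¬dep))

  from : ¬ (x ≡ 𝟎 × y ≡ 𝟎) × Dependent x y → HasRank (x ∷ y ∷ []) 1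
  from (nonzero , dep) = independent-row , maximal
    where
    independent-row : ∃ λ (f : Fin 1 → Fin 2) → Independent (select f (x ∷ y ∷ []))
    independent-row with x ≟ 𝟎
    ... | no  x≢𝟎 = (λ _ → zero) , Equivalence.from independent-singleton⇔ x≢𝟎
    ... | yes x≡𝟎 = (λ _ → suc zero)
                  , Equivalence.from independent-singleton⇔ (λ y≡𝟎 → nonzero (x≡𝟎 , y≡𝟎))

    maximal : ∀ (f : Fin 2 → Fin 2) → ¬ Independent (select f (x ∷ y ∷ []))
    maximal f ind = Equivalence.to independent-pair⇔ ind (rows-dependent dep (f zero) (f (suc zero)))

ord-≡⇔ : ∀ {k} {g h g′ h′ : F₂^ k} → ord g h ≡ ord g′ h′ ⇔ (g ⊕ g′ ≡ 𝟎 × h ⊕ h′ ≡ 𝟎)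
ord-≡⇔ = mk⇔ (λ { refl → ≡⇒⊕≡𝟎 refl , ≡⇒⊕≡𝟎 refl })
             (λ (g⊕g′≡𝟎 , h⊕h′≡𝟎) → cong₂ ord (⊕≡𝟎⇒≡ g⊕g′≡𝟎) (⊕≡𝟎⇒≡ h⊕h′≡𝟎))

b-injective : ∀ {k} {x y : F₂^ k} → b x ≡ b y → x ≡ y
b-injective refl = refl

shared-point⇔ : ∀ {k} {g h g′ h′ : F₂^ k} →
                (∃ λ p → p ∈ℓ ord g h × p ∈ℓ ord g′ h′) ⇔ Dependent (g ⊕ g′) (h ⊕ h′)
shared-point⇔ {g = g} {h} {g′} {h′} = mk⇔ to from
  where
  to : (∃ λ p → p ∈ℓ ord g h × p ∈ℓ ord g′ h′) → Dependent (g ⊕ g′) (h ⊕ h′)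
  to (_ , inj₁ refl        , inj₁ refl)        = inj₁ (≡⇒⊕≡𝟎 refl)
  to (_ , inj₂ (inj₁ refl) , inj₂ (inj₁ e))    = inj₂ (inj₂ (⊕-transpose (b-injective e)))
  to (_ , inj₂ (inj₂ refl) , inj₂ (inj₂ refl)) = inj₂ (inj₁ (≡⇒⊕≡𝟎 refl))
  to (_ , inj₁ refl        , inj₂ (inj₁ ()))
  to (_ , inj₁ refl        , inj₂ (inj₂ ()))
  to (_ , inj₂ (inj₁ refl) , inj₁ ())
  to (_ , inj₂ (inj₁ refl) , inj₂ (inj₂ ()))
  to (_ , inj₂ (inj₂ refl) , inj₁ ())
  to (_ , inj₂ (inj₂ refl) , inj₂ (inj₁ ()))

  from : Dependent (g ⊕ g′) (h ⊕ h′) → ∃ λ p → p ∈ℓ ord g h × p ∈ℓ ord g′ h′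
  from (inj₁ g⊕g′≡𝟎)        = a g , inj₁ refl , inj₁ (cong a (⊕≡𝟎⇒≡ g⊕g′≡𝟎))
  from (inj₂ (inj₁ h⊕h′≡𝟎)) = c h , inj₂ (inj₂ refl) , inj₂ (inj₂ (cong c (⊕≡𝟎⇒≡ h⊕h′≡𝟎)))
  from (inj₂ (inj₂ e))      = b (g ⊕ h) , inj₂ (inj₁ refl) , inj₂ (inj₁ (cong b (⊕-transpose e)))

rows : ∀ {k} → OrdinaryLine k → Matrix 2 k
rows (g , h) = g ∷ h ∷ []

fromRows : ∀ {k} → Matrix 2 k → OrdinaryLine k
fromRows (g ∷ h ∷ []) = g , h

theorem4p2 : (k : ℕ) → 1 ≤ k → GraphIso (LineGraph k) (BilinearFormsGraph k)
theorem4p2 k _ = record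
  { bij = mk↔ₛ′ rows fromRows (λ { (g ∷ h ∷ []) → refl }) (λ _ → refl)
  ; adj = λ (g , h) (g′ , h′) →
      ⇔-sym rank-one-pair⇔ ⇔-∘ (¬-cong-⇔ ord-≡⇔ ×-⇔ shared-point⇔)
  }
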